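{- Let $k\ge 2$ and $n>0$ be integers. The largest semisymmetric height attained by a $k$-dimensional balanced ballot path of length $kn$ is $\left\lfloor \frac{k}{2}\right\rfloor \left\lceil \frac{k}{2}\right\rceil n$.
   Context: A $k$-dimensional balanced ballot path of length $kn$ is a sequence $P=(\vec s_1,\dots,\vec s_{kn})$ of standard unit vectors of $\mathbb{R}^k$ in which each $\vec e_i$ ($1\le i\le k$) occurs exactly $n$ times, and such that every intermediate point $\vec v_i=\sum_{j=1}^i \vec s_j$ ($0\le i\le kn$), written $\vec x=(x_1,\dots,x_k)$, satisfies $x_1\ge x_2\ge\cdots\ge x_k$. The semisymmetric height of a point $\vec x\in\mathbb{Z}_{\ge0}^k$ is $g_k(\vec x)=\sum_{i=1}^k (k+1-2i)x_i$, and the semisymmetric height $g_k(P)$ of a path $P$ is the maximum of $g_k(\vec v_i)$ over all its intermediate points $\vec v_0,\dots,\vec v_{kn}$. -}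

module Defs where

open import Data.Nat as ℕ using (ℕ; suc)
open import Data.Integer as ℤ using (ℤ; +_; _⊔_)
open import Data.Fin using (Fin; toℕ; _≟_)
open import Data.List using (List; []; _∷_; filter; length; take; inits; foldr; map)
open import Data.List using (allFin)
open import Data.Product using (_×_)
open import Relation.Binary.PropositionalEquality using (_≡_)

-- A path in ℝ^k is a list of steps; step i (: Fin k) is the unit vector e_{i+1}.
Path : ℕ → Set
Path k = List (Fin k)

-- A lattice point of ℤ^k_{≥0}, coordinates x_1..x_k indexed by Fin k (0-based).
Point : ℕ → Set
Point k = Fin k → ℕ

endpoint : ∀ {k} → Path k → Point k
endpoint P i = length (filter (_≟ i) P)

intermediatePoints : ∀ {k} → Path k → List (Point k)
intermediatePoints P = map endpoint (inits P)

Weakly-decreasing : ∀ {k} → Point k → Set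
Weakly-decreasing {k} x = ∀ (i j : Fin k) → toℕ j ≡ suc (toℕ i) → x j ℕ.≤ x i

Balanced : ∀ {k} → ℕ → Path k → Set
Balanced {k} n P = ∀ (i : Fin k) → length (filter (_≟ i) P) ≡ n

Ballot : ∀ {k} → Path k → Set
Ballot {k} P = ∀ (m : ℕ) → m ℕ.≤ length P →
  Weakly-decreasing (endpoint (take m P))

BalancedBallotPath : (k n : ℕ) → Path k → Set
BalancedBallotPath k n P = Balanced n P × Ballot P

sumℤ : List ℤ → ℤ
sumℤ = foldr ℤ._+_ (+ 0)

-- g_k(x) = Σ_{i=1}^k (k+1-2i) x_i ; with 0-based index i this coefficient is k+1-2(i+1)
g : (k : ℕ) → Point k → ℤ
g k x = sumℤ (map (λ i → ((+ (suc k)) ℤ.- (+ 2) ℤ.* (+ suc (toℕ i))) ℤ.* (+ x i)) (allFin k))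

-- g_k(P) = max of g_k over the intermediate points v_0, …, v_{kn}
-- (v_0 = origin is among them, so starting the fold at g_k(v_0) is harmless)
height : (k : ℕ) → Path k → ℤ
height k P = foldr (λ v m → g k v ⊔ m) (g k (endpoint {k} [])) (intermediatePoints P)

{-# OPTIONS --safe #-}
-- The coordinates of every intermediate point of a balanced path lie in [0, n], and g_k is
-- linear with coefficient k + 1 - 2i on x_i, which is positive for i ≤ ⌊k/2⌋ and non-positive
-- beyond.  Hence g_k of such a point is at most its value at the corner (n, …, n, 0, …, 0) with
-- ⌊k/2⌋ entries n, which is n Σ_{i ≤ ⌊k/2⌋} (k + 1 - 2i) = ⌊k/2⌋ ⌈k/2⌉ n.  The staircase path e_1^n e_2^n ⋯ e_k^n is a balanced ballot path
-- that passes through this corner.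
module Submission where

open import Defs
open import Data.Bool using (true; false; if_then_else_)
open import Data.Fin using (Fin; zero; suc; toℕ; _≟_)
open import Data.Integer as ℤ using (ℤ; +_; 0ℤ; _⊔_; +≤+)
  renaming (_+_ to _+ℤ_; _-_ to _-ℤ_; _*_ to _*ℤ_; _≤_ to _≤ℤ_)
import Data.Integer.Properties as ℤ
open import Data.Integer.Solver using (module +-*-Solver)
open import Data.List using (List; []; _∷_; _++_; length; take; inits; foldr; map; replicate; tabulate; allFin)
import Data.List.Properties as List
open import Data.List.Relation.Binary.Sublist.Propositional.Properties using (filter⁺; take-⊆; length-mono-≤)
open import Data.Nat as ℕ using (ℕ; zero; suc; _≤_; _<_; _/_; _*_; _+_; _∸_; _⊓_; z≤n; s≤s; ⌊_/2⌋; ⌈_/2⌉)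
import Data.Nat.Properties as ℕ
open import Data.Nat.DivMod using (m/n≡1+[m∸n]/n)
open import Data.Product using (Σ; _×_; _,_)
open import Function using (_∘_; id)
open import Relation.Nullary using (yes; no)
open import Relation.Nullary.Reflects using (ofʸ; ofⁿ)
open import Relation.Binary.PropositionalEquality

take-++ : ∀ {A : Set} m (xs ys : List A) → take m (xs ++ ys) ≡ take m xs ++ take (m ∸ length xs) ys
take-++ zero    []       ys = refl
take-++ zero    (x ∷ xs) ys = refl
take-++ (suc m) []       ys = refl
take-++ (suc m) (x ∷ xs) ys = cong (x ∷_) (take-++ m xs ys)

take-replicate : ∀ {A : Set} m n (x : A) → take m (replicate n x) ≡ replicate (m ⊓ n) x
take-replicate zero    n       x = refl
take-replicate (suc m) zero    x = refl
take-replicate (suc m) (suc n) x = cong (x ∷_) (take-replicate m n x)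

maxOverPrefixes : {A : Set} → (List A → ℤ) → ℤ → List A → ℤ
maxOverPrefixes F b xs = foldr (λ ys acc → F ys ⊔ acc) b (inits xs)

maxOverPrefixes-∷ : ∀ {A : Set} (F : List A → ℤ) b x xs →
  maxOverPrefixes F b (x ∷ xs) ≡ F [] ⊔ maxOverPrefixes (F ∘ (x ∷_)) b xs
maxOverPrefixes-∷ F b x xs = cong (F [] ⊔_) (List.foldr-map (λ ys acc → F ys ⊔ acc) (x ∷_) b (inits xs))

take≤maxOverPrefixes : ∀ {A : Set} (F : List A → ℤ) b m xs → F (take m xs) ≤ℤ maxOverPrefixes F b xs
take≤maxOverPrefixes F b zero    xs       = ℤ.i≤i⊔j (F []) _
take≤maxOverPrefixes F b (suc m) []       = ℤ.i≤i⊔j (F []) b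
take≤maxOverPrefixes F b (suc m) (x ∷ xs) = begin
  F (x ∷ take m xs)                          ≤⟨ take≤maxOverPrefixes (F ∘ (x ∷_)) b m xs ⟩
  maxOverPrefixes (F ∘ (x ∷_)) b xs          ≤⟨ ℤ.i≤j⊔i (F []) _ ⟩
  F [] ⊔ maxOverPrefixes (F ∘ (x ∷_)) b xs   ≡⟨ maxOverPrefixes-∷ F b x xs ⟨
  maxOverPrefixes F b (x ∷ xs)               ∎
  where open ℤ.≤-Reasoning

maxOverPrefixes-lub : ∀ {A : Set} (F : List A → ℤ) {b c} xs →
  b ≤ℤ c → (∀ m → F (take m xs) ≤ℤ c) → maxOverPrefixes F b xs ≤ℤ c
maxOverPrefixes-lub F []       b≤c F≤c = ℤ.⊔-lub (F≤c 0) b≤c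
maxOverPrefixes-lub F (x ∷ xs) b≤c F≤c = subst (_≤ℤ _) (sym (maxOverPrefixes-∷ F _ x xs))
  (ℤ.⊔-lub (F≤c 0) (maxOverPrefixes-lub (F ∘ (x ∷_)) xs b≤c (F≤c ∘ suc)))

sumℤ-map-mono : ∀ {A : Set} {f f′ : A → ℤ} xs →
  (∀ a → f a ≤ℤ f′ a) → sumℤ (map f xs) ≤ℤ sumℤ (map f′ xs)
sumℤ-map-mono []       f≤f′ = ℤ.≤-refl
sumℤ-map-mono (x ∷ xs) f≤f′ = ℤ.+-mono-≤ (f≤f′ x) (sumℤ-map-mono xs f≤f′)

sumℤ-tabulate-zero : ∀ {k} {f : Fin k → ℤ} → (∀ i → f i ≡ 0ℤ) → sumℤ (tabulate f) ≡ 0ℤ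
sumℤ-tabulate-zero {zero}  f≗0 = refl
sumℤ-tabulate-zero {suc k} f≗0 = cong₂ _+ℤ_ (f≗0 zero) (sumℤ-tabulate-zero (f≗0 ∘ suc))

sumBelow : ℕ → (ℕ → ℤ) → ℤ
sumBelow zero    F = 0ℤ
sumBelow (suc h) F = F 0 +ℤ sumBelow h (F ∘ suc)

sumBelow-cong : ∀ h {F G : ℕ → ℤ} → (∀ t → F t ≡ G t) → sumBelow h F ≡ sumBelow h G
sumBelow-cong zero    F≗G = refl
sumBelow-cong (suc h) F≗G = cong₂ _+ℤ_ (F≗G 0) (sumBelow-cong h (F≗G ∘ suc))

-- Generalising over K lets the induction absorb the shift t ↦ t + 1 into K ↦ K - 2.
sumBelow-arithmetic : ∀ (K : ℤ) h → sumBelow h (λ t → K -ℤ + 2 *ℤ + suc t) ≡ + h *ℤ (K -ℤ + suc h)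
sumBelow-arithmetic K zero    = refl
sumBelow-arithmetic K (suc h) = begin
  K -ℤ + 2 *ℤ + 1 +ℤ sumBelow h (λ t → K -ℤ + 2 *ℤ + suc (suc t))
    ≡⟨ cong (ℤ._+_ (K -ℤ + 2 *ℤ + 1)) (sumBelow-cong h shift) ⟩
  K -ℤ + 2 *ℤ + 1 +ℤ sumBelow h (λ t → (K -ℤ + 2) -ℤ + 2 *ℤ + suc t)
    ≡⟨ cong (ℤ._+_ (K -ℤ + 2 *ℤ + 1)) (sumBelow-arithmetic (K -ℤ + 2) h) ⟩
  K -ℤ + 2 *ℤ + 1 +ℤ + h *ℤ ((K -ℤ + 2) -ℤ + suc h)
    ≡⟨ solve 2 (λ K H → K :- con (+ 2) :* con (+ 1) :+ H :* ((K :- con (+ 2)) :- (con (+ 1) :+ H))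
                     := (con (+ 1) :+ H) :* (K :- (con (+ 2) :+ H))) refl K (+ h) ⟩
  + suc h *ℤ (K -ℤ + suc (suc h)) ∎
  where
  open ≡-Reasoning
  open +-*-Solver
  shift : ∀ t → K -ℤ + 2 *ℤ + suc (suc t) ≡ (K -ℤ + 2) -ℤ + 2 *ℤ + suc t
  shift t = solve 2 (λ K T → K :- con (+ 2) :* (con (+ 1) :+ T) := (K :- con (+ 2)) :- con (+ 2) :* T)
                    refl K (+ suc t)

n/2≡⌊n/2⌋ : ∀ n → n / 2 ≡ ⌊ n /2⌋
n/2≡⌊n/2⌋ zero          = refl
n/2≡⌊n/2⌋ (suc zero)    = refl
n/2≡⌊n/2⌋ (suc (suc n)) = trans (m/n≡1+[m∸n]/n {suc (suc n)} {2} (s≤s (s≤s z≤n))) (cong suc (n/2≡⌊n/2⌋ n))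

[n+1]/2≡⌈n/2⌉ : ∀ n → (n + 1) / 2 ≡ ⌈ n /2⌉
[n+1]/2≡⌈n/2⌉ n = trans (cong (_/ 2) (ℕ.+-comm n 1)) (n/2≡⌊n/2⌋ (suc n))

2*n≡n+n : ∀ n → 2 * n ≡ n + n
2*n≡n+n n = cong (ℕ._+_ n) (ℕ.+-identityʳ n)

⌊n/2⌋+⌊n/2⌋≤n : ∀ n → ⌊ n /2⌋ + ⌊ n /2⌋ ≤ n
⌊n/2⌋+⌊n/2⌋≤n n = subst (⌊ n /2⌋ + ⌊ n /2⌋ ≤_) (ℕ.⌊n/2⌋+⌈n/2⌉≡n n) (ℕ.+-monoʳ-≤ ⌊ n /2⌋ (ℕ.⌊n/2⌋≤⌈n/2⌉ n))

n≤1+⌊n/2⌋+⌊n/2⌋ : ∀ n → n ≤ suc (⌊ n /2⌋ + ⌊ n /2⌋)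
n≤1+⌊n/2⌋+⌊n/2⌋ n = begin
  n                          ≡⟨ ℕ.⌊n/2⌋+⌈n/2⌉≡n n ⟨
  ⌊ n /2⌋ + ⌈ n /2⌉          ≤⟨ ℕ.+-monoʳ-≤ ⌊ n /2⌋ (ℕ.⌊n/2⌋-mono (ℕ.n≤1+n (suc n))) ⟩
  ⌊ n /2⌋ + suc ⌊ n /2⌋      ≡⟨ ℕ.+-suc ⌊ n /2⌋ ⌊ n /2⌋ ⟩
  suc (⌊ n /2⌋ + ⌊ n /2⌋)    ∎
  where open ℕ.≤-Reasoning

endpoint-map-suc-zero : ∀ {k} (xs : Path k) → endpoint (map suc xs) zero ≡ 0
endpoint-map-suc-zero []       = refl
endpoint-map-suc-zero (_ ∷ xs) = endpoint-map-suc-zero xs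

endpoint-map-suc-suc : ∀ {k} (xs : Path k) j → endpoint (map suc xs) (suc j) ≡ endpoint xs j
endpoint-map-suc-suc []       j = refl
endpoint-map-suc-suc (x ∷ xs) j with x ≟ j
... | yes _ = cong suc (endpoint-map-suc-suc xs j)
... | no  _ = endpoint-map-suc-suc xs j

endpoint-shift-zero : ∀ {k} r (xs : Path k) → endpoint (replicate r zero ++ map suc xs) zero ≡ r
endpoint-shift-zero zero    xs = endpoint-map-suc-zero xs
endpoint-shift-zero (suc r) xs = cong suc (endpoint-shift-zero r xs)

endpoint-shift-suc : ∀ {k} r (xs : Path k) j →
  endpoint (replicate r zero ++ map suc xs) (suc j) ≡ endpoint xs j
endpoint-shift-suc zero    xs j = endpoint-map-suc-suc xs j
endpoint-shift-suc (suc r) xs j = endpoint-shift-suc r xs j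

endpoint-take-≤ : ∀ {k} m (xs : Path k) j → endpoint (take m xs) j ≤ endpoint xs j
endpoint-take-≤ m xs j =
  length-mono-≤ (filter⁺ (_≟ j) (_≟ j) (λ a≡b a≡j → trans (sym a≡b) a≡j) (take-⊆ m xs))

staircase : (k n : ℕ) → Path k
staircase zero    n = []
staircase (suc k) n = replicate n zero ++ map suc (staircase k n)

take-staircase : ∀ k n m →
  take m (staircase (suc k) n) ≡ replicate (m ⊓ n) zero ++ map suc (take (m ∸ n) (staircase k n))
take-staircase k n m = begin
  take m (replicate n zero ++ map suc (staircase k n))
    ≡⟨ take-++ m (replicate n zero) _ ⟩
  take m (replicate n zero) ++ take (m ∸ length (replicate n zero)) (map suc (staircase k n))
    ≡⟨ cong₂ _++_ (take-replicate m n zero)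
                  (cong (λ l → take (m ∸ l) (map suc (staircase k n))) (List.length-replicate n)) ⟩
  replicate (m ⊓ n) zero ++ take (m ∸ n) (map suc (staircase k n))
    ≡⟨ cong (replicate (m ⊓ n) zero ++_) (List.take-map (m ∸ n) (staircase k n)) ⟩
  replicate (m ⊓ n) zero ++ map suc (take (m ∸ n) (staircase k n)) ∎
  where open ≡-Reasoning

endpoint-take-staircase : ∀ k n m (j : Fin k) → endpoint (take m (staircase k n)) j ≡ n ⊓ (m ∸ toℕ j * n)
endpoint-take-staircase (suc k) n m zero rewrite take-staircase k n m =
  trans (endpoint-shift-zero (m ⊓ n) _) (ℕ.⊓-comm m n)
endpoint-take-staircase (suc k) n m (suc j) rewrite take-staircase k n m =
  trans (endpoint-shift-suc (m ⊓ n) _ j)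
        (trans (endpoint-take-staircase k n (m ∸ n) j) (cong (n ⊓_) (ℕ.∸-+-assoc m n (toℕ j * n))))

staircase-balanced : ∀ k n → Balanced n (staircase k n)
staircase-balanced (suc k) n zero    = endpoint-shift-zero n (staircase k n)
staircase-balanced (suc k) n (suc j) =
  trans (endpoint-shift-suc n (staircase k n) j) (staircase-balanced k n j)

staircase-ballot : ∀ k n → Ballot (staircase k n)
staircase-ballot k n m _ i j j≡1+i
  rewrite endpoint-take-staircase k n m i | endpoint-take-staircase k n m j | j≡1+i =
  ℕ.⊓-monoʳ-≤ n (ℕ.∸-monoʳ-≤ m (ℕ.m≤n+m (toℕ i * n) n))

staircase-balancedBallotPath : ∀ k n → BalancedBallotPath k n (staircase k n)
staircase-balancedBallotPath k n = staircase-balanced k n , staircase-ballot k n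

corner : ∀ {k} → ℕ → ℕ → Point k
corner h n i = if toℕ i ℕ.<ᵇ h then n else 0

endpoint-take-staircase-corner : ∀ k n h (j : Fin k) →
  endpoint (take (h * n) (staircase k n)) j ≡ corner h n j
endpoint-take-staircase-corner k n h j
  rewrite endpoint-take-staircase k n (h * n) j | sym (ℕ.*-distribʳ-∸ n h (toℕ j))
  with toℕ j ℕ.<ᵇ h | ℕ.<ᵇ-reflects-< (toℕ j) h
... | true  | ofʸ j<h = ℕ.m≤n⇒m⊓n≡m (ℕ.m≤n*m n (h ∸ toℕ j) {{ℕ.>-nonZero (ℕ.m<n⇒0<n∸m j<h)}})
... | false | ofⁿ j≮h = trans (cong (λ d → n ⊓ (d * n)) (ℕ.m≤n⇒m∸n≡0 (ℕ.≮⇒≥ j≮h))) (ℕ.⊓-zeroʳ n)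

coeff : ℕ → ℕ → ℤ
coeff k t = + suc k -ℤ + 2 *ℤ + suc t

g-cong : ∀ k {x y : Point k} → (∀ i → x i ≡ y i) → g k x ≡ g k y
g-cong k x≗y = cong sumℤ (List.map-cong (λ i → cong (λ v → coeff k (toℕ i) *ℤ + v) (x≗y i)) (allFin k))

coeff-nonneg : ∀ k {t} → t < ⌊ k /2⌋ → 0ℤ ≤ℤ coeff k t
coeff-nonneg k {t} t<h = subst (0ℤ ≤ℤ_) (sym (ℤ.⊖-≥ 2[1+t]≤1+k)) (+≤+ z≤n)
  where
  open ℕ.≤-Reasoning
  2[1+t]≤1+k : 2 * suc t ≤ suc k
  2[1+t]≤1+k = begin
    2 * suc t               ≡⟨ 2*n≡n+n (suc t) ⟩
    suc t + suc t           ≤⟨ ℕ.+-mono-≤ t<h t<h ⟩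
    ⌊ k /2⌋ + ⌊ k /2⌋       ≤⟨ ⌊n/2⌋+⌊n/2⌋≤n k ⟩
    k                       ≤⟨ ℕ.n≤1+n k ⟩
    suc k                   ∎

coeff-nonpos : ∀ k {t} → ⌊ k /2⌋ ≤ t → coeff k t ≤ℤ 0ℤ
coeff-nonpos k {t} h≤t = subst (_≤ℤ 0ℤ) (sym (ℤ.⊖-≤ 1+k≤2[1+t])) ℤ.neg-≤-pos
  where
  open ℕ.≤-Reasoning
  1+k≤2[1+t] : suc k ≤ 2 * suc t
  1+k≤2[1+t] = begin
    suc k                           ≤⟨ s≤s (n≤1+⌊n/2⌋+⌊n/2⌋ k) ⟩
    suc (suc (⌊ k /2⌋ + ⌊ k /2⌋))   ≤⟨ s≤s (s≤s (ℕ.+-mono-≤ h≤t h≤t)) ⟩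
    suc (suc (t + t))               ≡⟨ cong suc (ℕ.+-suc t t) ⟨
    suc t + suc t                   ≡⟨ 2*n≡n+n (suc t) ⟨
    2 * suc t                       ∎

coeff-*-≤-corner : ∀ k t {x n} → x ≤ n →
  coeff k t *ℤ + x ≤ℤ coeff k t *ℤ + (if t ℕ.<ᵇ ⌊ k /2⌋ then n else 0)
coeff-*-≤-corner k t x≤n with t ℕ.<ᵇ ⌊ k /2⌋ | ℕ.<ᵇ-reflects-< t ⌊ k /2⌋
... | true  | ofʸ t<h = ℤ.*-monoˡ-≤-nonNeg (coeff k t) {{ℤ.nonNegative (coeff-nonneg k t<h)}} (+≤+ x≤n)
... | false | ofⁿ t≮h = ℤ.*-monoˡ-≤-nonPos (coeff k t) {{ℤ.nonPositive (coeff-nonpos k (ℕ.≮⇒≥ t≮h))}} (+≤+ z≤n)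

g≤g-corner : ∀ k n (x : Point k) → (∀ i → x i ≤ n) → g k x ≤ℤ g k (corner ⌊ k /2⌋ n)
g≤g-corner k n x x≤n = sumℤ-map-mono (allFin k) (λ i → coeff-*-≤-corner k (toℕ i) (x≤n i))

sumℤ-tabulate-corner : ∀ k h n (F : ℕ → ℤ) → h ≤ k →
  sumℤ (tabulate {n = k} (λ i → F (toℕ i) *ℤ + corner h n i)) ≡ sumBelow h F *ℤ + n
sumℤ-tabulate-corner k zero n F _ = sumℤ-tabulate-zero {k} (λ i → ℤ.*-zeroʳ (F (toℕ i)))
sumℤ-tabulate-corner (suc k) (suc h) n F (s≤s h≤k) =
  trans (cong (ℤ._+_ (F 0 *ℤ + n)) (sumℤ-tabulate-corner k h n (F ∘ suc) h≤k))
        (sym (ℤ.*-distribʳ-+ (+ n) (F 0) (sumBelow h (F ∘ suc))))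

g-corner : ∀ k h n → h ≤ k → g k (corner h n) ≡ + (h * (k ∸ h) * n)
g-corner k h n h≤k = begin
  g k (corner h n)
    ≡⟨ cong sumℤ (List.map-tabulate {n = k} id (λ i → coeff k (toℕ i) *ℤ + corner h n i)) ⟩
  sumℤ (tabulate {n = k} (λ i → coeff k (toℕ i) *ℤ + corner h n i))
    ≡⟨ sumℤ-tabulate-corner k h n (coeff k) h≤k ⟩
  sumBelow h (coeff k) *ℤ + n
    ≡⟨ cong (_*ℤ + n) (sumBelow-arithmetic (+ suc k) h) ⟩
  + h *ℤ (suc k ℤ.⊖ suc h) *ℤ + n
    ≡⟨ cong (λ d → + h *ℤ d *ℤ + n) (trans (ℤ.[1+m]⊖[1+n]≡m⊖n k h) (ℤ.⊖-≥ h≤k)) ⟩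
  + h *ℤ + (k ∸ h) *ℤ + n
    ≡⟨ cong (_*ℤ + n) (ℤ.pos-* h (k ∸ h)) ⟨
  + (h * (k ∸ h)) *ℤ + n
    ≡⟨ ℤ.pos-* (h * (k ∸ h)) n ⟨
  + (h * (k ∸ h) * n) ∎
  where open ≡-Reasoning

g-corner-half : ∀ k n → g k (corner ⌊ k /2⌋ n) ≡ + (⌊ k /2⌋ * ⌈ k /2⌉ * n)
g-corner-half k n =
  trans (g-corner k ⌊ k /2⌋ n (ℕ.⌊n/2⌋≤n k)) (cong (λ c → + (⌊ k /2⌋ * c * n)) k∸⌊k/2⌋≡⌈k/2⌉)
  where
  k∸⌊k/2⌋≡⌈k/2⌉ : k ∸ ⌊ k /2⌋ ≡ ⌈ k /2⌉
  k∸⌊k/2⌋≡⌈k/2⌉ = trans (cong (_∸ ⌊ k /2⌋) (sym (ℕ.⌊n/2⌋+⌈n/2⌉≡n k))) (ℕ.m+n∸m≡n ⌊ k /2⌋ ⌈ k /2⌉)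

height≡maxOverPrefixes : ∀ k P → height k P ≡ maxOverPrefixes (g k ∘ endpoint) (g k (endpoint [])) P
height≡maxOverPrefixes k P = List.foldr-map (λ v acc → g k v ⊔ acc) endpoint (g k (endpoint [])) (inits P)

g-prefix≤height : ∀ k P m → g k (endpoint (take m P)) ≤ℤ height k P
g-prefix≤height k P m = subst (g k (endpoint (take m P)) ≤ℤ_) (sym (height≡maxOverPrefixes k P))
  (take≤maxOverPrefixes (g k ∘ endpoint) _ m P)

height-lub : ∀ k P {c} → (∀ m → g k (endpoint (take m P)) ≤ℤ c) → height k P ≤ℤ c
height-lub k P {c} g≤c = subst (_≤ℤ c) (sym (height≡maxOverPrefixes k P))
  (maxOverPrefixes-lub (g k ∘ endpoint) P (g≤c 0) g≤c)

height≤g-corner : ∀ k n P → Balanced n P → height k P ≤ℤ g k (corner ⌊ k /2⌋ n)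
height≤g-corner k n P balanced = height-lub k P (λ m →
  g≤g-corner k n _ (λ i → ℕ.≤-trans (endpoint-take-≤ m P i) (ℕ.≤-reflexive (balanced i))))

height-staircase : ∀ k n → height k (staircase k n) ≡ g k (corner ⌊ k /2⌋ n)
height-staircase k n = ℤ.≤-antisym (height≤g-corner k n (staircase k n) (staircase-balanced k n)) (begin
  g k (corner ⌊ k /2⌋ n)                               ≡⟨ g-cong k (endpoint-take-staircase-corner k n ⌊ k /2⌋) ⟨
  g k (endpoint (take (⌊ k /2⌋ * n) (staircase k n))) ≤⟨ g-prefix≤height k (staircase k n) (⌊ k /2⌋ * n) ⟩
  height k (staircase k n)                             ∎)
  where open ℤ.≤-Reasoning

proposition2p22 : (k n : ℕ) → 2 ≤ k → 0 < n →
    (Σ (Path k) (λ P → BalancedBallotPath k n P × height k P ≡ + ((k / 2) * ((k + 1) / 2) * n)))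
    × (∀ (P : Path k) → BalancedBallotPath k n P → height k P ≤ℤ + ((k / 2) * ((k + 1) / 2) * n))
proposition2p22 k n _ _ rewrite n/2≡⌊n/2⌋ k | [n+1]/2≡⌈n/2⌉ k | sym (g-corner-half k n) =
  (staircase k n , staircase-balancedBallotPath k n , height-staircase k n) ,
  λ P (balanced , _) → height≤g-corner k n P balanced
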